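{- Let $n=2k$ with $k\ge 6$ an integer. Then there exist $E,F\subseteq\mathbb{Z}_n$ which are not translates of each other but have the same $3$-deck.
   Context: For $f:\mathbb{Z}_n\to\mathbb{R}$, the $3$-deck is $N_{f,3}(x_1,x_2)=\sum_{x\in\mathbb{Z}_n} f(x)f(x+x_1)f(x+x_2)$ for $x_1,x_2\in\mathbb{Z}_n$; the $3$-deck of $E\subseteq\mathbb{Z}_n$ is that of its indicator function. $E$ and $F$ are translates of each other if $F=E+t$ for some $t\in\mathbb{Z}_n$. -}

module Defs where

open import Data.Nat using (ℕ; zero; suc; _+_; _*_; NonZero)
open import Data.Nat.DivMod using (_mod_)
open import Data.Fin using (Fin; toℕ)
open import Data.Bool using (Bool; true; false)
open import Data.Vec.Functional using (Vector; foldr)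
open import Data.Product using (∃)
open import Relation.Binary.PropositionalEquality using (_≡_)

ℤ/ : ℕ → Set
ℤ/ n = Fin n

_⊕_ : ∀ {n} .{{_ : NonZero n}} → ℤ/ n → ℤ/ n → ℤ/ n
_⊕_ {n} x y = (toℕ x + toℕ y) mod n

SubsetZ : ℕ → Set
SubsetZ n = ℤ/ n → Bool

-- indicator function 1_E : ℤ_n → ℕ (values in ℕ ⊆ ℝ)
𝟙 : ∀ {n} → SubsetZ n → ℤ/ n → ℕ
𝟙 E x with E x
... | true  = 1
... | false = 0

Σℤ : ∀ {n} → (ℤ/ n → ℕ) → ℕ
Σℤ f = foldr _+_ 0 f

deck3 : ∀ {n} .{{_ : NonZero n}} → (ℤ/ n → ℕ) → ℤ/ n → ℤ/ n → ℕ
deck3 f x₁ x₂ = Σℤ (λ x → f x * f (x ⊕ x₁) * f (x ⊕ x₂))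

deck3S : ∀ {n} .{{_ : NonZero n}} → SubsetZ n → ℤ/ n → ℤ/ n → ℕ
deck3S E = deck3 (𝟙 E)

SameDeck3 : ∀ {n} .{{_ : NonZero n}} → SubsetZ n → SubsetZ n → Set
SameDeck3 E F = ∀ x₁ x₂ → deck3S E x₁ x₂ ≡ deck3S F x₁ x₂

-- F = E + t : y ∈ F ↔ y = x + t for some x ∈ E, i.e. F (x + t) = E x for all x
-- (x ↦ x + t is a bijection of ℤ_n)
Translate : ∀ {n} .{{_ : NonZero n}} → SubsetZ n → SubsetZ n → Set
Translate {n} E F = ∃ λ (t : ℤ/ n) → ∀ x → F (x ⊕ t) ≡ E x

module Submission where

-- Let h = k, the element of order 2 in ℤ_2k, and let A ⊆ ℤ_2k ∖ {0, h} contain exactly one of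
-- y, −y for every y ∉ {0, h} and satisfy A + h = −A. Put E = A ∪ {0} and F = A ∪ {h}. Both
-- decks are the deck of A plus the triples through the added point. Recording for each y
-- whether it is 0, in A, h or in −A by an element of ℤ/4, the contribution of the triangle
-- {0, a, b} at h becomes its contribution at 0 with every class negated, i.e. with all edges of
-- the triangle reversed, and a check over the 64 sign patterns shows this changes nothing (a
-- tournament on three vertices has as many sources as sinks). For A = {2, …, k−2} ∪ {k+1, 2k−1}
-- the sets E and F are not translates: evaluating F (x + t) = E x at x = 0, 1, 2, 4 rules out
-- every t as soon as k ≥ 6.

open import Defs
open import Level using (0ℓ)
open import Algebra.Bundles using (AbelianGroup)
open import Algebra.Structures using (IsAbelianGroup)
import Algebra.Properties.AbelianGroup
open import Data.Bool using (Bool; true; false; not; _∨_; _∧_; if_then_else_)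
open import Data.Bool.Properties using (∧-comm; not-involutive)
open import Data.Empty using (⊥; ⊥-elim)
open import Data.Fin using (toℕ; punchIn)
open import Data.Fin.Patterns using (0F; 1F; 2F; 3F)
open import Data.Fin.Properties using (toℕ-fromℕ<; toℕ-injective; toℕ<n; punchInᵢ≢i; _≟_; all?)
open import Data.Nat
  using (ℕ; zero; suc; s≤s; z≤n; _+_; _*_; _∸_; _%_; _<_; _≤_; _<?_; _≤?_; NonZero; >-nonZero⁻¹)
open import Data.Nat.DivMod using (_mod_; %-distribˡ-+; m<n⇒m%n≡m; [m+n]%n≡m%n)
open import Data.Nat.Properties as ℕ
  using ( +-comm; +-assoc; +-identityʳ; *-zeroʳ; *-identityʳ; +-0-commutativeMonoid; m*n≢0
        ; <⇒≤; ≤-pred; ≤-antisym; ≰⇒>; ≮⇒≥; n≮0; <-≤-trans; m≤m+n; +-monoˡ-<; +-cancelʳ-<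
        ; ∸-monoʳ-<; m<n⇒0<n∸m; m+[n∸m]≡n; m+n∸n≡m; m∸n+n≡m; +-∸-comm; m∸[m∸n]≡n
        ; m+n≤o⇒m≤o∸n; m≤o∸n⇒m+n≤o)
open import Data.Nat.Tactic.RingSolver using (solve-∀)
open import Algebra.Properties.CommutativeMonoid.Sum +-0-commutativeMonoid
  using (sum-remove; sum-cong-≗; sum-replicate-zero; ∑-distrib-+)
open import Data.Product using (∃₂; _×_; _,_; proj₂)
open import Data.Sum using (_⊎_; inj₁; inj₂)
open import Data.Vec.Functional using (Vector; replicate)
open import Function using (_∘_; case_of_)
open import Relation.Nullary using (¬_)
open import Relation.Nullary.Decidable
  using ( Dec; yes; no; does; True; toWitness; from-yes; decidable-stable; dec-true; dec-false
        ; _×-dec_; _⊎-dec_; _→-dec_)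
open import Relation.Binary.PropositionalEquality
  using (_≡_; _≢_; _≗_; refl; sym; trans; cong; cong₂; subst; isEquivalence; module ≡-Reasoning)

module _ {n : ℕ} .{{_ : NonZero n}} where

  [_] : ℕ → ℤ/ n
  [ m ] = m mod n

  0# : ℤ/ n
  0# = [ 0 ]

  infix 25 -_
  -_ : ℤ/ n → ℤ/ n
  - x = [ n ∸ toℕ x ]

  toℕ-[] : ∀ m → toℕ [ m ] ≡ m % n
  toℕ-[] m = toℕ-fromℕ< _

  toℕ-[]-< : ∀ {m} → m < n → toℕ [ m ] ≡ m
  toℕ-[]-< {m} m<n = trans (toℕ-[] m) (m<n⇒m%n≡m m<n)

  [toℕ] : ∀ x → [ toℕ x ] ≡ x
  [toℕ] x = toℕ-injective (toℕ-[]-< (toℕ<n x))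

  [+] : ∀ a b → [ a ] ⊕ [ b ] ≡ [ a + b ]
  [+] a b = toℕ-injective (begin
    toℕ ([ a ] ⊕ [ b ])          ≡⟨ toℕ-[] _ ⟩
    (toℕ [ a ] + toℕ [ b ]) % n  ≡⟨ cong₂ (λ u v → (u + v) % n) (toℕ-[] a) (toℕ-[] b) ⟩
    (a % n + b % n) % n          ≡⟨ %-distribˡ-+ a b n ⟨
    (a + b) % n                  ≡⟨ toℕ-[] (a + b) ⟨
    toℕ [ a + b ]                ∎)
    where open ≡-Reasoning

  [n] : [ n ] ≡ 0#
  [n] = toℕ-injective (trans (toℕ-[] n) (trans ([m+n]%n≡m%n 0 n) (sym (toℕ-[] 0))))

  ⊕-comm : ∀ x y → x ⊕ y ≡ y ⊕ x
  ⊕-comm x y = cong [_] (+-comm (toℕ x) (toℕ y))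

  ⊕-assoc : ∀ x y z → (x ⊕ y) ⊕ z ≡ x ⊕ (y ⊕ z)
  ⊕-assoc x y z = begin
    [ toℕ x + toℕ y ] ⊕ z                ≡⟨ cong ([ toℕ x + toℕ y ] ⊕_) ([toℕ] z) ⟨
    [ toℕ x + toℕ y ] ⊕ [ toℕ z ]        ≡⟨ [+] (toℕ x + toℕ y) (toℕ z) ⟩
    [ toℕ x + toℕ y + toℕ z ]            ≡⟨ cong [_] (+-assoc (toℕ x) (toℕ y) (toℕ z)) ⟩
    [ toℕ x + (toℕ y + toℕ z) ]          ≡⟨ [+] (toℕ x) (toℕ y + toℕ z) ⟨
    [ toℕ x ] ⊕ [ toℕ y + toℕ z ]        ≡⟨ cong (_⊕ (y ⊕ z)) ([toℕ] x) ⟩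
    x ⊕ (y ⊕ z)                          ∎
    where open ≡-Reasoning

  ⊕-identityˡ : ∀ x → 0# ⊕ x ≡ x
  ⊕-identityˡ x = begin
    [ 0 ] ⊕ x          ≡⟨ cong ([ 0 ] ⊕_) ([toℕ] x) ⟨
    [ 0 ] ⊕ [ toℕ x ]  ≡⟨ [+] 0 (toℕ x) ⟩
    [ toℕ x ]          ≡⟨ [toℕ] x ⟩
    x                  ∎
    where open ≡-Reasoning

  ⊕-identityʳ : ∀ x → x ⊕ 0# ≡ x
  ⊕-identityʳ x = trans (⊕-comm x 0#) (⊕-identityˡ x)

  ⊕-inverseʳ : ∀ x → x ⊕ - x ≡ 0#
  ⊕-inverseʳ x = begin
    x ⊕ - x                  ≡⟨ cong (_⊕ - x) ([toℕ] x) ⟨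
    [ toℕ x ] ⊕ - x          ≡⟨ [+] (toℕ x) (n ∸ toℕ x) ⟩
    [ toℕ x + (n ∸ toℕ x) ]  ≡⟨ cong [_] (m+[n∸m]≡n (<⇒≤ (toℕ<n x))) ⟩
    [ n ]                    ≡⟨ [n] ⟩
    0#                       ∎
    where open ≡-Reasoning

  infixl 20 _⊖_
  _⊖_ : ℤ/ n → ℤ/ n → ℤ/ n
  x ⊖ y = x ⊕ - y

ℤ/-isAbelianGroup : ∀ n .{{_ : NonZero n}} → IsAbelianGroup {A = ℤ/ n} _≡_ _⊕_ 0# -_
ℤ/-isAbelianGroup n = record
  { isGroup = record
    { isMonoid = record
      { isSemigroup = record
        { isMagma = record { isEquivalence = isEquivalence ; ∙-cong = cong₂ _⊕_ }
        ; assoc   = ⊕-assoc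
        }
      ; identity = ⊕-identityˡ , ⊕-identityʳ
      }
    ; inverse = (λ x → trans (⊕-comm (- x) x) (⊕-inverseʳ x)) , ⊕-inverseʳ
    ; ⁻¹-cong = cong -_
    }
  ; comm = ⊕-comm
  }

ℤ/-abelianGroup : ∀ n .{{_ : NonZero n}} → AbelianGroup 0ℓ 0ℓ
ℤ/-abelianGroup n = record { isAbelianGroup = ℤ/-isAbelianGroup n }

module _ {n : ℕ} .{{_ : NonZero n}} where
  open Algebra.Properties.AbelianGroup (ℤ/-abelianGroup n)
    using (x≈z//y; //-rightDividesˡ; ⁻¹-anti-homo‿-)

  ⊕-⊖-cancel : ∀ x y → x ⊕ (y ⊖ x) ≡ y
  ⊕-⊖-cancel x y = trans (⊕-comm x (y ⊖ x)) (//-rightDividesˡ x y)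

  ⊖-⊕-swap : ∀ x y z → (x ⊖ y) ⊕ z ≡ x ⊕ (z ⊖ y)
  ⊖-⊕-swap x y z = trans (⊕-assoc x (- y) z) (cong (x ⊕_) (⊕-comm (- y) z))

  -‿⊖ : ∀ x y → - (x ⊖ y) ≡ y ⊖ x
  -‿⊖ = ⁻¹-anti-homo‿-

  at : ℤ/ n → SubsetZ n
  at p x = does (x ≟ p)

  _∪_ : SubsetZ n → SubsetZ n → SubsetZ n
  (S ∪ T) x = S x ∨ T x

  record IsDirac (d : ℤ/ n → ℕ) (p : ℤ/ n) : Set where
    field
      at-point  : d p ≡ 1
      off-point : ∀ x → x ≢ p → d x ≡ 0

  isDirac-shift : ∀ {d p} c → IsDirac d p → IsDirac (λ x → d (x ⊕ c)) (p ⊖ c)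
  isDirac-shift {d} {p} c δ = record
    { at-point  = trans (cong d (//-rightDividesˡ c p)) (IsDirac.at-point δ)
    ; off-point = λ x x≢p⊖c → IsDirac.off-point δ (x ⊕ c) (x≢p⊖c ∘ x≈z//y x c p)
    }

𝟙-true : ∀ {n} (S : SubsetZ n) {x} → S x ≡ true → 𝟙 S x ≡ 1
𝟙-true S {x} Sx with S x
... | true = refl

𝟙-false : ∀ {n} (S : SubsetZ n) {x} → S x ≡ false → 𝟙 S x ≡ 0
𝟙-false S {x} Sx with S x
... | false = refl

𝟙-∘ : ∀ {m n} (S : SubsetZ m) (f : ℤ/ n → ℤ/ m) x → 𝟙 (S ∘ f) x ≡ 𝟙 S (f x)
𝟙-∘ S f x with S (f x)
... | true  = refl
... | false = refl

Σℤ-supportedAt : ∀ {n} (f : Vector ℕ n) p → (∀ x → x ≢ p → f x ≡ 0) → Σℤ f ≡ f p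
Σℤ-supportedAt {suc n} f p vanish = begin
  Σℤ f                               ≡⟨ sum-remove {i = p} f ⟩
  f p + Σℤ (λ j → f (punchIn p j))   ≡⟨ cong (f p +_) (sum-cong-≗ (λ j → vanish _ (punchInᵢ≢i p j))) ⟩
  f p + Σℤ (replicate n 0)           ≡⟨ cong (f p +_) (sum-replicate-zero n) ⟩
  f p + 0                            ≡⟨ +-identityʳ (f p) ⟩
  f p                                ∎
  where open ≡-Reasoning

module _ {n : ℕ} .{{_ : NonZero n}} where

  Σℤ-dirac : ∀ {d p} (g : ℤ/ n → ℕ) → IsDirac d p → Σℤ (λ x → g x * d x) ≡ g p
  Σℤ-dirac {d} {p} g δ = begin
    Σℤ (λ x → g x * d x)  ≡⟨ Σℤ-supportedAt _ p vanish ⟩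
    g p * d p             ≡⟨ cong (g p *_) (IsDirac.at-point δ) ⟩
    g p * 1               ≡⟨ *-identityʳ (g p) ⟩
    g p                   ∎
    where
    open ≡-Reasoning
    vanish : ∀ x → x ≢ p → g x * d x ≡ 0
    vanish x x≢p = trans (cong (g x *_) (IsDirac.off-point δ x x≢p)) (*-zeroʳ (g x))

  -- The triples (x, x ⊕ a, x ⊕ b) through p, sorted by the first position that holds p.
  corner : (f α : ℤ/ n → ℕ) (p a b : ℤ/ n) → ℕ
  corner f α p a b = f (p ⊕ a) * f (p ⊕ b) + (α (p ⊖ a) * f ((p ⊖ a) ⊕ b) + α (p ⊖ b) * α ((p ⊖ b) ⊕ a))

  deck3-+dirac : ∀ {d p} (α : ℤ/ n → ℕ) → IsDirac d p → ∀ a b →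
    deck3 (λ x → α x + d x) a b ≡ deck3 α a b + corner (λ x → α x + d x) α p a b
  deck3-+dirac {d} {p} α δ a b = begin
    Σℤ (λ x → f x * f (x ⊕ a) * f (x ⊕ b))
      ≡⟨ sum-cong-≗ (λ x → telescope (α x) (d x) (α (x ⊕ a)) (d (x ⊕ a)) (α (x ⊕ b)) (d (x ⊕ b))) ⟩
    Σℤ (λ x → α x * α (x ⊕ a) * α (x ⊕ b) + (t₀ x + (t₁ x + t₂ x)))
      ≡⟨ ∑-distrib-+ (λ x → α x * α (x ⊕ a) * α (x ⊕ b)) (λ x → t₀ x + (t₁ x + t₂ x)) ⟩
    deck3 α a b + Σℤ (λ x → t₀ x + (t₁ x + t₂ x))
      ≡⟨ cong (deck3 α a b +_) (∑-distrib-+ t₀ (λ x → t₁ x + t₂ x)) ⟩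
    deck3 α a b + (Σℤ t₀ + Σℤ (λ x → t₁ x + t₂ x))
      ≡⟨ cong (λ s → deck3 α a b + (Σℤ t₀ + s)) (∑-distrib-+ t₁ t₂) ⟩
    deck3 α a b + (Σℤ t₀ + (Σℤ t₁ + Σℤ t₂))
      ≡⟨ cong (deck3 α a b +_) (cong₂ _+_ (Σℤ-dirac (λ x → f (x ⊕ a) * f (x ⊕ b)) δ)
           (cong₂ _+_ (Σℤ-dirac (λ x → α x * f (x ⊕ b)) (isDirac-shift a δ))
                      (Σℤ-dirac (λ x → α x * α (x ⊕ a)) (isDirac-shift b δ)))) ⟩
    deck3 α a b + corner f α p a b ∎
    where
    open ≡-Reasoning
    f t₀ t₁ t₂ : ℤ/ n → ℕ
    f x = α x + d x
    t₀ x = f (x ⊕ a) * f (x ⊕ b) * d x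
    t₁ x = α x * f (x ⊕ b) * d (x ⊕ a)
    t₂ x = α x * α (x ⊕ a) * d (x ⊕ b)
    telescope : ∀ u₀ v₀ u₁ v₁ u₂ v₂ → (u₀ + v₀) * (u₁ + v₁) * (u₂ + v₂)
      ≡ u₀ * u₁ * u₂ + ((u₁ + v₁) * (u₂ + v₂) * v₀ + (u₀ * (u₂ + v₂) * v₁ + u₀ * u₁ * v₂))
    telescope = solve-∀

  deck3-cong : ∀ {f g : ℤ/ n → ℕ} → f ≗ g → ∀ a b → deck3 f a b ≡ deck3 g a b
  deck3-cong f≗g a b = sum-cong-≗ (λ x → cong₂ _*_ (cong₂ _*_ (f≗g x) (f≗g (x ⊕ a))) (f≗g (x ⊕ b)))

Even : ℤ/ 4 → Set
Even s = s ≡ 0F ⊎ s ≡ 2F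

even? : ∀ s → Dec (Even s)
even? s = s ≟ 0F ⊎-dec s ≟ 2F

-- Holds for the classes of a, b and b ⊖ a: adding 0 or h to y adds 0 or 2 to the class of y.
Consistent : ℤ/ 4 → ℤ/ 4 → ℤ/ 4 → Set
Consistent s₁ s₂ s₃ = Even s₁ ⊎ Even s₂ ⊎ Even s₃ → s₁ ⊕ s₃ ≡ s₂

consistent? : ∀ s₁ s₂ s₃ → Dec (Consistent s₁ s₂ s₃)
consistent? s₁ s₂ s₃ = (even? s₁ ⊎-dec even? s₂ ⊎-dec even? s₃) →-dec (s₁ ⊕ s₃ ≟ s₂)

-- class y is 0 at y = 0, 2 at y = h, 1 on A and 3 on −A = A + h.
record Splitting {n} .{{_ : NonZero n}} (h : ℤ/ n) : Set where
  field
    class     : ℤ/ n → ℤ/ 4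
    class-0   : class 0# ≡ 0F
    class≡0   : ∀ y → class y ≡ 0F → y ≡ 0#
    class≡2   : ∀ y → class y ≡ 2F → y ≡ h
    class-⊕h  : ∀ y → class (y ⊕ h) ≡ class y ⊕ 2F
    class-neg : ∀ y → class (- y) ≡ - class y

cornerᶜ : (c π : ℤ/ 4 → ℕ) (t s₁ s₂ s₃ : ℤ/ 4) → ℕ
cornerᶜ c π t s₁ s₂ s₃ = c (t ⊕ s₁) * c (t ⊕ s₂) + (π (t ⊖ s₁) * c (t ⊕ s₃) + π (t ⊖ s₂) * π (t ⊖ s₃))

cornerᴱ cornerᶠ : ℤ/ 4 → ℤ/ 4 → ℤ/ 4 → ℕ
cornerᴱ = cornerᶜ (𝟙 (at 0F ∪ at 1F)) (𝟙 (at 1F)) 0F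
cornerᶠ = cornerᶜ (𝟙 (at 1F ∪ at 2F)) (𝟙 (at 1F)) 2F

corner-reversal : ∀ s₁ s₂ s₃ → Consistent s₁ s₂ s₃ → cornerᴱ s₁ s₂ s₃ ≡ cornerᶠ s₁ s₂ s₃
corner-reversal = from-yes (all? λ s₁ → all? λ s₂ → all? λ s₃ →
  consistent? s₁ s₂ s₃ →-dec cornerᴱ s₁ s₂ s₃ ℕ.≟ cornerᶠ s₁ s₂ s₃)

module SplittingDeck {n} .{{_ : NonZero n}} {h : ℤ/ n} (S : Splitting h) where
  open Splitting S

  class-h : class h ≡ 2F
  class-h = trans (cong class (sym (⊕-identityˡ h))) (trans (class-⊕h 0#) (cong (_⊕ 2F) class-0))

  class-pole-⊕ : ∀ {p} → Even (class p) → ∀ y → class (p ⊕ y) ≡ class p ⊕ class y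
  class-pole-⊕ {p} (inj₁ p↦0) y = begin
    class (p ⊕ y)      ≡⟨ cong (λ q → class (q ⊕ y)) (class≡0 p p↦0) ⟩
    class (0# ⊕ y)     ≡⟨ cong class (⊕-identityˡ y) ⟩
    class y            ≡⟨ ⊕-identityˡ (class y) ⟨
    0F ⊕ class y       ≡⟨ cong (_⊕ class y) p↦0 ⟨
    class p ⊕ class y  ∎
    where open ≡-Reasoning
  class-pole-⊕ {p} (inj₂ p↦2) y = begin
    class (p ⊕ y)      ≡⟨ cong (λ q → class (q ⊕ y)) (class≡2 p p↦2) ⟩
    class (h ⊕ y)      ≡⟨ cong class (⊕-comm h y) ⟩
    class (y ⊕ h)      ≡⟨ class-⊕h y ⟩
    class y ⊕ 2F       ≡⟨ ⊕-comm (class y) 2F ⟩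
    2F ⊕ class y       ≡⟨ cong (_⊕ class y) p↦2 ⟨
    class p ⊕ class y  ∎
    where open ≡-Reasoning

  class-pole-⊖ : ∀ {p} → Even (class p) → ∀ y → class (p ⊖ y) ≡ class p ⊖ class y
  class-pole-⊖ {p} even y = trans (class-pole-⊕ even (- y)) (cong (class p ⊕_) (class-neg y))

  pole-unique : ∀ {p y} → Even (class p) → class y ≡ class p → y ≡ p
  pole-unique {p} {y} (inj₁ p↦0) y↦p = trans (class≡0 y (trans y↦p p↦0)) (sym (class≡0 p p↦0))
  pole-unique {p} {y} (inj₂ p↦2) y↦p = trans (class≡2 y (trans y↦p p↦2)) (sym (class≡2 p p↦2))

  consistent : ∀ a b → Consistent (class a) (class b) (class (b ⊖ a))
  consistent a b (inj₁ a-even) =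
    trans (sym (class-pole-⊕ a-even (b ⊖ a))) (cong class (⊕-⊖-cancel a b))
  consistent a b (inj₂ (inj₁ b-even)) =
    trans (cong (class a ⊕_) (class-pole-⊖ b-even a)) (⊕-⊖-cancel (class a) (class b))
  consistent a b (inj₂ (inj₂ b⊖a-even)) = trans (⊕-comm (class a) (class (b ⊖ a)))
    (trans (sym (class-pole-⊕ b⊖a-even a)) (cong class (trans (⊕-comm (b ⊖ a) a) (⊕-⊖-cancel a b))))

  corner-class : ∀ {p} → Even (class p) → {f α : ℤ/ n → ℕ} (c π : ℤ/ 4 → ℕ) →
    (∀ y → f y ≡ c (class y)) → (∀ y → α y ≡ π (class y)) → ∀ a b →
    corner f α p a b ≡ cornerᶜ c π (class p) (class a) (class b) (class (b ⊖ a))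
  corner-class {p} even {f} {α} c π f≡ α≡ a b =
    cong₂ _+_ (cong₂ _*_ (f-at (class-pole-⊕ even a)) (f-at (class-pole-⊕ even b)))
      (cong₂ _+_ (cong₂ _*_ (α-at (class-pole-⊖ even a)) (f-at class-[p⊖a]⊕b))
                 (cong₂ _*_ (α-at (class-pole-⊖ even b)) (α-at class-[p⊖b]⊕a)))
    where
    f-at : ∀ {y s} → class y ≡ s → f y ≡ c s
    f-at {y} y↦s = trans (f≡ y) (cong c y↦s)
    α-at : ∀ {y s} → class y ≡ s → α y ≡ π s
    α-at {y} y↦s = trans (α≡ y) (cong π y↦s)
    class-[p⊖a]⊕b : class ((p ⊖ a) ⊕ b) ≡ class p ⊕ class (b ⊖ a)
    class-[p⊖a]⊕b = trans (cong class (⊖-⊕-swap p a b)) (class-pole-⊕ even (b ⊖ a))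
    class-[p⊖b]⊕a : class ((p ⊖ b) ⊕ a) ≡ class p ⊖ class (b ⊖ a)
    class-[p⊖b]⊕a = trans (cong class (trans (⊖-⊕-swap p b a) (cong (p ⊕_) (sym (-‿⊖ b a)))))
                          (class-pole-⊖ even (b ⊖ a))

  α : ℤ/ n → ℕ
  α y = 𝟙 (at 1F) (class y)

  isDirac-pole : ∀ {p t} → class p ≡ t → Even t → IsDirac (λ y → 𝟙 (at t) (class y)) p
  isDirac-pole {p} {t} p↦t even = record
    { at-point  = 𝟙-true (at t) {class p} (dec-true (class p ≟ t) p↦t)
    ; off-point = λ y y≢p → 𝟙-false (at t) {class y} (dec-false (class y ≟ t)
        (λ y↦t → y≢p (pole-unique (subst Even (sym p↦t) even) (trans y↦t (sym p↦t)))))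
    }

  deck3-pole : ∀ (T : SubsetZ 4) {p t} → class p ≡ t → Even t →
    (∀ s → 𝟙 T s ≡ 𝟙 (at 1F) s + 𝟙 (at t) s) → ∀ a b →
    deck3S (T ∘ class) a b
      ≡ deck3 α a b + cornerᶜ (𝟙 T) (𝟙 (at 1F)) t (class a) (class b) (class (b ⊖ a))
  deck3-pole T {p} {t} p↦t even T-split a b = begin
    deck3S (T ∘ class) a b
      ≡⟨ deck3-cong 𝟙T∘class≗α+d a b ⟩
    deck3 (λ y → α y + d y) a b
      ≡⟨ deck3-+dirac α (isDirac-pole p↦t even) a b ⟩
    deck3 α a b + corner (λ y → α y + d y) α p a b
      ≡⟨ cong (deck3 α a b +_) (corner-class (subst Even (sym p↦t) even) (𝟙 T) (𝟙 (at 1F))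
           (λ y → sym (T-split (class y))) (λ _ → refl) a b) ⟩
    deck3 α a b + cornerᶜ (𝟙 T) (𝟙 (at 1F)) (class p) (class a) (class b) (class (b ⊖ a))
      ≡⟨ cong (λ u → deck3 α a b + cornerᶜ (𝟙 T) (𝟙 (at 1F)) u (class a) (class b) (class (b ⊖ a))) p↦t ⟩
    deck3 α a b + cornerᶜ (𝟙 T) (𝟙 (at 1F)) t (class a) (class b) (class (b ⊖ a)) ∎
    where
    open ≡-Reasoning
    d : ℤ/ n → ℕ
    d y = 𝟙 (at t) (class y)
    𝟙T∘class≗α+d : 𝟙 (T ∘ class) ≗ λ y → α y + d y
    𝟙T∘class≗α+d y = trans (𝟙-∘ T class y) (T-split (class y))

  E F : SubsetZ n
  E = (at 0F ∪ at 1F) ∘ class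
  F = (at 1F ∪ at 2F) ∘ class

  sameDeck3 : SameDeck3 E F
  sameDeck3 a b = begin
    deck3S E a b
      ≡⟨ deck3-pole (at 0F ∪ at 1F) class-0 (inj₁ refl) E-split a b ⟩
    deck3 α a b + cornerᴱ (class a) (class b) (class (b ⊖ a))
      ≡⟨ cong (deck3 α a b +_) (corner-reversal (class a) (class b) (class (b ⊖ a)) (consistent a b)) ⟩
    deck3 α a b + cornerᶠ (class a) (class b) (class (b ⊖ a))
      ≡⟨ deck3-pole (at 1F ∪ at 2F) class-h (inj₂ refl) F-split a b ⟨
    deck3S F a b ∎
    where
    open ≡-Reasoning
    E-split : ∀ s → 𝟙 (at 0F ∪ at 1F) s ≡ 𝟙 (at 1F) s + 𝟙 (at 0F) s
    E-split = from-yes (all? λ (s : ℤ/ 4) → 𝟙 (at 0F ∪ at 1F) s ℕ.≟ 𝟙 (at 1F) s + 𝟙 (at 0F) s)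
    F-split : ∀ s → 𝟙 (at 1F ∪ at 2F) s ≡ 𝟙 (at 1F) s + 𝟙 (at 2F) s
    F-split = from-yes (all? λ (s : ℤ/ 4) → 𝟙 (at 1F ∪ at 2F) s ℕ.≟ 𝟙 (at 1F) s + 𝟙 (at 2F) s)

-- A = {e : 0 < e < k, B e} ∪ {e + k : 0 < e < k, ¬ B e}; palindromy of B keeps A and −A disjoint.
module PalindromicSplitting (k : ℕ) .{{_ : NonZero k}} (B : ℕ → Bool)
    (B-palindromic : ∀ e → 0 < e → e < k → B (k ∸ e) ≡ B e) where

  n : ℕ
  n = 2 * k

  instance
    n-nonZero : NonZero n
    n-nonZero = m*n≢0 2 k

  open Algebra.Properties.AbelianGroup (ℤ/-abelianGroup n)
    using (ε⁻¹≈ε; inverseʳ-unique; ⁻¹-∙-comm)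
  module ℤ/4 = Algebra.Properties.AbelianGroup (ℤ/-abelianGroup 4)

  h : ℤ/ n
  h = [ k ]

  odd : Bool → ℤ/ 4
  odd true  = 1F
  odd false = 3F

  half : ℕ → ℤ/ 4
  half zero      = 0F
  half e@(suc _) = odd (B e)

  classℕ : ℕ → ℤ/ 4
  classℕ d = if does (d <? k) then half d else half (d ∸ k) ⊕ 2F

  class : ℤ/ n → ℤ/ 4
  class y = classℕ (toℕ y)

  k+k≡n : k + k ≡ n
  k+k≡n = cong (k +_) (sym (+-identityʳ k))

  <k⇒<n : ∀ {e} → e < k → e < n
  <k⇒<n e<k = <-≤-trans e<k (subst (k ≤_) k+k≡n (m≤m+n k k))

  +k<n : ∀ {e} → e < k → e + k < n
  +k<n {e} e<k = subst (e + k <_) k+k≡n (+-monoˡ-< k e<k)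

  h⊕h : h ⊕ h ≡ 0#
  h⊕h = trans ([+] k k) (trans (cong [_] k+k≡n) [n])

  classℕ-lower : ∀ {d} → d < k → classℕ d ≡ half d
  classℕ-lower {d} d<k rewrite dec-true (d <? k) d<k = refl

  classℕ-upper : ∀ e → classℕ (e + k) ≡ half e ⊕ 2F
  classℕ-upper e rewrite dec-false (e + k <? k) (n≮0 ∘ +-cancelʳ-< k e 0) | m+n∸n≡m e k = refl

  class-lower : ∀ {e} → e < k → class [ e ] ≡ half e
  class-lower e<k = trans (cong classℕ (toℕ-[]-< (<k⇒<n e<k))) (classℕ-lower e<k)

  class-upper : ∀ {e} → e < k → class ([ e ] ⊕ h) ≡ half e ⊕ 2F
  class-upper {e} e<k =
    trans (cong class ([+] e k)) (trans (cong classℕ (toℕ-[]-< (+k<n e<k))) (classℕ-upper e))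

  data HalfView (y : ℤ/ n) : Set where
    lower : ∀ {e} → e < k → y ≡ [ e ] → HalfView y
    upper : ∀ {e} → e < k → y ≡ [ e ] ⊕ h → HalfView y

  halfView : ∀ y → HalfView y
  halfView y with toℕ y <? k
  ... | yes d<k = lower d<k (sym ([toℕ] y))
  ... | no  d≮k = upper e<k (begin
    y                  ≡⟨ [toℕ] y ⟨
    [ toℕ y ]          ≡⟨ cong [_] (m∸n+n≡m k≤d) ⟨
    [ toℕ y ∸ k + k ]  ≡⟨ [+] (toℕ y ∸ k) k ⟨
    [ toℕ y ∸ k ] ⊕ h  ∎)
    where
    open ≡-Reasoning
    k≤d : k ≤ toℕ y
    k≤d = ≮⇒≥ d≮k
    e<k : toℕ y ∸ k < k
    e<k = +-cancelʳ-< k (toℕ y ∸ k) k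
            (subst (_< k + k) (sym (m∸n+n≡m k≤d)) (subst (toℕ y <_) (sym k+k≡n) (toℕ<n y)))

  odd≢0 : ∀ b → odd b ≢ 0F
  odd≢0 true  ()
  odd≢0 false ()

  odd≢2 : ∀ b → odd b ≢ 2F
  odd≢2 true  ()
  odd≢2 false ()

  odd-⊕2 : ∀ b → odd b ⊕ 2F ≡ - odd b
  odd-⊕2 true  = refl
  odd-⊕2 false = refl

  half≡0 : ∀ {e} → half e ≡ 0F → e ≡ 0
  half≡0 {zero}  _  = refl
  half≡0 {suc e} eq = ⊥-elim (odd≢0 (B (suc e)) eq)

  half≢2 : ∀ e → half e ≢ 2F
  half≢2 zero    ()
  half≢2 (suc e) = odd≢2 (B (suc e))

  half-pos : ∀ {e} → 0 < e → half e ≡ odd (B e)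
  half-pos {suc e} _ = refl

  half-palindromic : ∀ {e} → 0 < e → e < k → half (k ∸ e) ≡ half e
  half-palindromic {e} 0<e e<k = begin
    half (k ∸ e)     ≡⟨ half-pos (m<n⇒0<n∸m e<k) ⟩
    odd (B (k ∸ e))  ≡⟨ cong odd (B-palindromic e 0<e e<k) ⟩
    odd (B e)        ≡⟨ half-pos 0<e ⟨
    half e           ∎
    where open ≡-Reasoning

  class-0 : class 0# ≡ 0F
  class-0 = class-lower (>-nonZero⁻¹ k)

  class≡0 : ∀ y → class y ≡ 0F → y ≡ 0#
  class≡0 y y↦0 with halfView y
  ... | lower e<k refl = cong [_] (half≡0 (trans (sym (class-lower e<k)) y↦0))
  ... | upper {e} e<k refl =
    ⊥-elim (half≢2 e (ℤ/4.x≈z//y (half e) 2F 0F (trans (sym (class-upper e<k)) y↦0)))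

  class≡2 : ∀ y → class y ≡ 2F → y ≡ h
  class≡2 y y↦2 with halfView y
  ... | lower {e} e<k refl = ⊥-elim (half≢2 e (trans (sym (class-lower e<k)) y↦2))
  ... | upper {e} e<k refl = begin
    [ e ] ⊕ h  ≡⟨ cong (λ d → [ d ] ⊕ h) (half≡0 half-e≡0) ⟩
    0# ⊕ h     ≡⟨ ⊕-identityˡ h ⟩
    h          ∎
    where
    open ≡-Reasoning
    half-e≡0 : half e ≡ 0F
    half-e≡0 = ℤ/4.x≈z//y (half e) 2F 2F (trans (sym (class-upper e<k)) y↦2)

  class-⊕h : ∀ y → class (y ⊕ h) ≡ class y ⊕ 2F
  class-⊕h y with halfView y
  ... | lower e<k refl = trans (class-upper e<k) (cong (_⊕ 2F) (sym (class-lower e<k)))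
  ... | upper {e} e<k refl = begin
    class (([ e ] ⊕ h) ⊕ h)  ≡⟨ cong class (⊕-assoc [ e ] h h) ⟩
    class ([ e ] ⊕ (h ⊕ h))  ≡⟨ cong (λ z → class ([ e ] ⊕ z)) h⊕h ⟩
    class ([ e ] ⊕ 0#)       ≡⟨ cong class (⊕-identityʳ [ e ]) ⟩
    class [ e ]              ≡⟨ class-lower e<k ⟩
    half e                   ≡⟨ ⊕-identityʳ (half e) ⟨
    half e ⊕ (2F ⊕ 2F)       ≡⟨ ⊕-assoc (half e) 2F 2F ⟨
    (half e ⊕ 2F) ⊕ 2F       ≡⟨ cong (_⊕ 2F) (class-upper e<k) ⟨
    class ([ e ] ⊕ h) ⊕ 2F   ∎
    where open ≡-Reasoning

  class-neg-lower : ∀ {e} → e < k → class (- [ e ]) ≡ - class [ e ]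
  class-neg-lower {zero} _ = trans (cong class ε⁻¹≈ε) (trans class-0 (cong -_ (sym class-0)))
  class-neg-lower {e@(suc _)} e<k = begin
    class (- [ e ])        ≡⟨ cong (λ d → class [ n ∸ d ]) (toℕ-[]-< (<k⇒<n e<k)) ⟩
    class [ n ∸ e ]        ≡⟨ cong (λ m → class [ m ]) n∸e≡ ⟩
    class [ (k ∸ e) + k ]  ≡⟨ cong class ([+] (k ∸ e) k) ⟨
    class ([ k ∸ e ] ⊕ h)  ≡⟨ class-upper (∸-monoʳ-< (s≤s z≤n) (<⇒≤ e<k)) ⟩
    half (k ∸ e) ⊕ 2F      ≡⟨ cong (_⊕ 2F) (half-palindromic (s≤s z≤n) e<k) ⟩
    odd (B e) ⊕ 2F         ≡⟨ odd-⊕2 (B e) ⟩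
    - half e               ≡⟨ cong -_ (class-lower e<k) ⟨
    - class [ e ]          ∎
    where
    open ≡-Reasoning
    n∸e≡ : n ∸ e ≡ (k ∸ e) + k
    n∸e≡ = trans (cong (_∸ e) (sym k+k≡n)) (+-∸-comm k (<⇒≤ e<k))

  class-neg : ∀ y → class (- y) ≡ - class y
  class-neg y with halfView y
  ... | lower e<k refl = class-neg-lower e<k
  ... | upper {e} e<k refl = begin
    class (- ([ e ] ⊕ h))  ≡⟨ cong class (⁻¹-∙-comm [ e ] h) ⟨
    class (- [ e ] ⊕ - h)  ≡⟨ cong (λ z → class (- [ e ] ⊕ z)) (inverseʳ-unique h h h⊕h) ⟨
    class (- [ e ] ⊕ h)    ≡⟨ class-⊕h (- [ e ]) ⟩
    class (- [ e ]) ⊕ 2F   ≡⟨ cong (_⊕ 2F) (class-neg-lower e<k) ⟩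
    - class [ e ] ⊕ 2F     ≡⟨ ℤ/4.⁻¹-∙-comm (class [ e ]) 2F ⟩
    - (class [ e ] ⊕ 2F)   ≡⟨ cong -_ (class-⊕h [ e ]) ⟨
    - class ([ e ] ⊕ h)    ∎
    where open ≡-Reasoning

  splitting : Splitting h
  splitting = record
    { class     = class
    ; class-0   = class-0
    ; class≡0   = class≡0
    ; class≡2   = class≡2
    ; class-⊕h  = class-⊕h
    ; class-neg = class-neg
    }

module Counterexample (m : ℕ) where

  k : ℕ
  k = 6 + m

  far? : ∀ e → Dec (2 ≤ e × 2 ≤ k ∸ e)
  far? e = 2 ≤? e ×-dec 2 ≤? k ∸ e

  far : ℕ → Bool
  far e = does (far? e)

  far-palindromic : ∀ e → 0 < e → e < k → far (k ∸ e) ≡ far e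
  far-palindromic e _ e<k = trans (cong (λ d → does (2 ≤? k ∸ e) ∧ does (2 ≤? d)) (m∸[m∸n]≡n (<⇒≤ e<k)))
                                  (∧-comm (does (2 ≤? k ∸ e)) (does (2 ≤? e)))

  open PalindromicSplitting k far far-palindromic
  open SplittingDeck splitting public using (E; F; sameDeck3)

  far-true : ∀ {e} → far e ≡ true → 2 ≤ k ∸ e
  far-true {e} eq = decidable-stable (2 ≤? k ∸ e)
    (λ 2≰k∸e → case trans (sym eq) (dec-false (far? e) (2≰k∸e ∘ proj₂)) of λ ())

  far-false : ∀ {e} → 2 ≤ e → far e ≡ false → ¬ 2 ≤ k ∸ e
  far-false {e} 2≤e eq 2≤k∸e = case trans (sym eq) (dec-true (far? e) (2≤e , 2≤k∸e)) of λ ()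

  F-odd : ∀ b → (at 1F ∪ at 2F) (odd b) ≡ b
  F-odd true  = refl
  F-odd false = refl

  F-odd⊕2 : ∀ b → (at 1F ∪ at 2F) (odd b ⊕ 2F) ≡ not b
  F-odd⊕2 true  = refl
  F-odd⊕2 false = refl

  pinned : ∀ {x} → x ≤ 3 + m → ¬ 2 ≤ (4 + m) ∸ x → x ≡ 3 + m
  pinned {x} x≤3+m 2≰ = ≤-antisym x≤3+m (≤-pred (≤-pred (≰⇒> (2≰ ∘ m+n≤o⇒m≤o∸n 2))))

  small : ∀ j → {True (j <? k)} → j < k
  small j {j<k} = toWitness j<k

  F-lower : ∀ {j} → j < k → F [ j ] ≡ (at 1F ∪ at 2F) (half j)
  F-lower j<k = cong (at 1F ∪ at 2F) (class-lower j<k)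

  F-upper : ∀ {j} → j < k → F ([ j ] ⊕ h) ≡ (at 1F ∪ at 2F) (half j ⊕ 2F)
  F-upper j<k = cong (at 1F ∪ at 2F) (class-upper j<k)

  E-lower : ∀ {j} → j < k → E [ j ] ≡ (at 0F ∪ at 1F) (half j)
  E-lower j<k = cong (at 0F ∪ at 1F) (class-lower j<k)

  lowerShift-impossible : ∀ {u} → u < k → ¬ (∀ x → F (x ⊕ [ u ]) ≡ E x)
  lowerShift-impossible {zero} _ shift =
    case trans (sym (F-lower (small 0))) (trans (shift [ 0 ]) (E-lower (small 0))) of λ ()
  lowerShift-impossible {suc u} u<k shift =
    case trans (sym F[8+m]) (trans probe-4 (E-lower (small 4))) of λ ()
    where
    probe : ∀ j → F [ j + suc u ] ≡ E [ j ]
    probe j = trans (cong F (sym ([+] j (suc u)))) (shift [ j ])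
    u-far : far (suc u) ≡ true
    u-far = trans (sym (F-odd _)) (trans (sym (F-lower u<k)) (trans (probe 0) (E-lower (small 0))))
    u≤3+m : u ≤ 3 + m
    u≤3+m = ≤-pred (≤-pred (m≤o∸n⇒m+n≤o 2 (<⇒≤ (≤-pred u<k)) (far-true {suc u} u-far)))
    next-near : far (2 + u) ≡ false
    next-near = trans (sym (F-odd _))
      (trans (sym (F-lower (s≤s (s≤s (s≤s u≤3+m))))) (trans (probe 1) (E-lower (small 1))))
    probe-4 : F [ 8 + m ] ≡ E [ 4 ]
    probe-4 = subst (λ v → F [ 4 + suc v ] ≡ E [ 4 ])
      (pinned u≤3+m (far-false {2 + u} (s≤s (s≤s z≤n)) next-near)) (probe 4)
    F[8+m] : F [ 8 + m ] ≡ false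
    F[8+m] = trans (cong F (sym ([+] 2 k))) (F-upper (small 2))

  upperShift-impossible : ∀ {e} → e < k → ¬ (∀ x → F (x ⊕ ([ e ] ⊕ h)) ≡ E x)
  upperShift-impossible {e} e<k shift = impossible e e<k (probe 0) (probe 1) (probe 2)
    where
    probe : ∀ j → F ([ j + e ] ⊕ h) ≡ E [ j ]
    probe j = trans (cong F (trans (cong (_⊕ h) (sym ([+] j e))) (⊕-assoc [ j ] [ e ] h))) (shift [ j ])
    impossible : ∀ e → e < k → F ([ e ] ⊕ h) ≡ E [ 0 ] → F ([ 1 + e ] ⊕ h) ≡ E [ 1 ] →
                 F ([ 2 + e ] ⊕ h) ≡ E [ 2 ] → ⊥
    impossible zero _ _ probe-1 _ =
      case trans (sym (F-upper (small 1))) (trans probe-1 (E-lower (small 1))) of λ ()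
    impossible (suc zero) _ _ _ probe-2 =
      case trans (sym (F-upper (small 3))) (trans probe-2 (E-lower (small 2))) of λ ()
    impossible (suc (suc e)) e<k probe-0 _ probe-2 =
      case trans (sym F[7+m]⊕h) (trans probe-2′ (E-lower (small 2))) of λ ()
      where
      e-near : far (2 + e) ≡ false
      e-near = trans (sym (not-involutive _)) (cong not (trans (sym (F-odd⊕2 _))
                 (trans (sym (F-upper e<k)) (trans probe-0 (E-lower (small 0))))))
      probe-2′ : F ([ 7 + m ] ⊕ h) ≡ E [ 2 ]
      probe-2′ = subst (λ v → F ([ 4 + v ] ⊕ h) ≡ E [ 2 ])
        (pinned (≤-pred (≤-pred (≤-pred e<k))) (far-false {2 + e} (s≤s (s≤s z≤n)) e-near)) probe-2
      F[7+m]⊕h : F ([ 7 + m ] ⊕ h) ≡ false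
      F[7+m]⊕h = trans (cong (λ y → F (y ⊕ h)) (sym ([+] 1 k)))
        (cong (at 1F ∪ at 2F) (trans (class-⊕h ([ 1 ] ⊕ h)) (cong (_⊕ 2F) (class-upper (small 1)))))

  notTranslate : ¬ Translate E F
  notTranslate (t , shift) with halfView t
  ... | lower u<k refl = lowerShift-impossible u<k shift
  ... | upper e<k refl = upperShift-impossible e<k shift

theorem2 : (k : ℕ) → 6 ≤ k → {{nz : NonZero (2 * k)}} → ∃₂ λ (E F : SubsetZ (2 * k)) → (¬ Translate E F) × SameDeck3 E F
theorem2 _ (s≤s (s≤s (s≤s (s≤s (s≤s (s≤s {n = m} z≤n)))))) = E , F , notTranslate , sameDeck3
  where open Counterexample m
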